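{- Let $G\subseteq K_{m,r+1}$ be a bipartite graph with left vertices $1,\dots,m$ and right vertices $0',1',\dots,r'$ and no isolated vertices, and let $T$ be a spanning tree of $G$. If $I'$ is a set of right vertices with $|I'|<r+1$, then $LD_T(\chi_T^{ -1}(I'))\geq|I'|$. If $I$ is a nonempty set of left vertices with $|I|<m$, then $|\chi_T(I)|\geq LD_T(I)+1$.
   Context: For a set $I'$ of right vertices, $\chi_T^{ -1}(I')$ is the set of left vertices adjacent in $T$ to some vertex of $I'$; for a set $I$ of left vertices, $\chi_T(I)$ is the set of right vertices adjacent in $T$ to some vertex of $I$. The left degree vector of $T$ is $(d_1,\dots,d_m)$ with $d_i=\deg_T(i)-1$, and $LD_T(I)=\sum_{i\in I}d_i$. -}

module Defs where

open import Data.Nat using (ℕ; zero; suc; _+_; _∸_; _≤_; _<_)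
open import Data.Bool using (Bool; true; false; _∧_; _∨_; if_then_else_)
open import Data.Fin using (Fin; zero; suc)
open import Data.Fin.Subset using (Subset)
open import Data.Vec using (Vec; lookup; tabulate)
open import Data.List using (List; []; _∷_; length)
open import Data.List.Relation.Unary.Unique.Propositional using (Unique)
open import Data.Sum using (_⊎_; inj₁; inj₂)
open import Data.Product using (_×_; Σ; ∃; ∃-syntax)
open import Data.Empty using (⊥)
open import Relation.Binary.PropositionalEquality using (_≡_)

-- A bipartite graph ⊆ K_{m,r+1}: left vertices Fin m (= 1..m),
-- right vertices Fin (suc r) (= 0',1',…,r'), edges given by a Boolean matrix.
BipGraph : ℕ → ℕ → Set
BipGraph m r = Fin m → Fin (suc r) → Bool

anyFin : ∀ {n} → (Fin n → Bool) → Bool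
anyFin {zero}  f = false
anyFin {suc n} f = f zero ∨ anyFin (λ i → f (suc i))

countFin : ∀ {n} → (Fin n → Bool) → ℕ
countFin {zero}  f = 0
countFin {suc n} f = (if f zero then 1 else 0) + countFin (λ i → f (suc i))

sumFin : ∀ {n} → (Fin n → ℕ) → ℕ
sumFin {zero}  f = 0
sumFin {suc n} f = f zero + sumFin (λ i → f (suc i))

module _ {m r : ℕ} where

  Vtx : Set
  Vtx = Fin m ⊎ Fin (suc r)

  Adj : BipGraph m r → Vtx → Vtx → Set
  Adj G (inj₁ i) (inj₂ j) = G i j ≡ true
  Adj G (inj₂ j) (inj₁ i) = G i j ≡ true
  Adj G (inj₁ _) (inj₁ _) = ⊥
  Adj G (inj₂ _) (inj₂ _) = ⊥

  _⊆G_ : BipGraph m r → BipGraph m r → Set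
  T ⊆G G = ∀ i j → T i j ≡ true → G i j ≡ true

  NoIsolated : BipGraph m r → Set
  NoIsolated G = (∀ i → ∃[ j ] G i j ≡ true) × (∀ j → ∃[ i ] G i j ≡ true)

  data Walk (G : BipGraph m r) : Vtx → Vtx → Set where
    nil  : ∀ {u} → Walk G u u
    cons : ∀ {u w v} → Adj G u w → Walk G w v → Walk G u v

  Connected : BipGraph m r → Set
  Connected G = ∀ u v → Walk G u v

  ChainTo : BipGraph m r → Vtx → List Vtx → Vtx → Set
  ChainTo G u []       w = Adj G u w
  ChainTo G u (x ∷ xs) w = Adj G u x × ChainTo G x xs w

  IsCycle : BipGraph m r → Vtx → List Vtx → Set
  IsCycle G v xs = (2 ≤ length xs) × Unique (v ∷ xs) × ChainTo G v xs v

  Acyclic : BipGraph m r → Set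
  Acyclic G = ∀ v xs → IsCycle G v xs → ⊥

  IsSpanningTree : BipGraph m r → BipGraph m r → Set
  IsSpanningTree T G = (T ⊆G G) × Connected T × Acyclic T

  degL : BipGraph m r → Fin m → ℕ
  degL T i = countFin (λ j → T i j)

  leftDeg : BipGraph m r → Fin m → ℕ
  leftDeg T i = degL T i ∸ 1

  LD : BipGraph m r → Subset m → ℕ
  LD T I = sumFin (λ i → if lookup I i then leftDeg T i else 0)

  χ : BipGraph m r → Subset m → Subset (suc r)
  χ T I = tabulate (λ j → anyFin (λ i → lookup I i ∧ T i j))

  χ⁻¹ : BipGraph m r → Subset (suc r) → Subset m
  χ⁻¹ T I' = tabulate (λ i → anyFin (λ j → lookup I' j ∧ T i j))

module Submission where

-- Root T at a vertex ρ.  Breadth-first search gives a height function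
-- (the least k such that ρ is reachable from v in k steps) and a parent map
-- with parent ρ = ρ, every other vertex adjacent to its parent and strictly
-- higher than it.  Since T is acyclic, every edge of T joins a vertex to its
-- parent.  Hence a left vertex i has degree ch(i) + [i ≠ ρ], where ch(i) is
-- its number of children, and every right vertex has at most one parent.
--   * Rooting T at a right vertex j₀ ∉ I', every j ∈ I' has its parent in
--     χ⁻¹(I') and d_i = ch(i) for all left i, so
--     |I'| ≤ Σ_{i ∈ χ⁻¹(I')} ch(i) = LD_T(χ⁻¹(I')).
--   * Rooting T at a left vertex i₀ ∈ I, d_i = ch(i) for i ≠ i₀ and
--     d_{i₀} = ch(i₀) - 1 with ch(i₀) ≥ 1, while the children of the vertices
--     of I are distinct elements of χ_T(I); so LD_T(I) + 1 ≤ |χ_T(I)|.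

open import Defs
open import Data.Nat using (ℕ; zero; suc; _+_; _∸_; _≤_; _<_; z≤n; s≤s)
open import Data.Nat.Properties
open import Data.Bool using (Bool; true; false; _∧_; if_then_else_) renaming (_≟_ to _≟B_)
open import Data.Bool.Properties using (¬-not)
open import Data.Fin using (Fin; zero; suc)
import Data.Fin.Properties as Fin
open import Data.Fin.Subset using (Subset; ∣_∣; Nonempty)
open import Data.Vec using ([]; _∷_; lookup)
open import Data.Vec.Properties using ([]=⇒lookup; lookup∘tabulate)
open import Data.List using (List; []; _∷_; _++_; [_]; length)
open import Data.List.Properties using (++-assoc)
open import Data.List.Relation.Unary.Linked using (Linked; [-]; _∷_)
open import Data.List.Relation.Unary.All as All using (All; _∷_)
open import Data.List.Relation.Unary.All.Properties using (++⁻ˡ; ¬Any⇒All¬)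
open import Data.List.Relation.Unary.AllPairs as AllPairs using (AllPairs; _∷_)
open import Data.List.Relation.Unary.Any using (here; there)
open import Data.List.Relation.Unary.Unique.Propositional using (Unique)
open import Data.List.Membership.Propositional using (_∈_; _∉_)
open import Data.List.Membership.Propositional.Properties using (∈-∃++)
import Data.List.Membership.DecPropositional as DecMembership
open import Data.Sum using (_⊎_; inj₁; inj₂; [_,_]′)
open import Data.Sum.Properties using (≡-dec; inj₁-injective; inj₂-injective)
open import Data.Product using (_×_; _,_; ∃; ∃-syntax; proj₁; proj₂)
open import Data.Empty using (⊥; ⊥-elim)
open import Data.Unit using (⊤; tt)
open import Function using (_∘_)
open import Relation.Nullary using (¬_; Dec; yes; no; does)
open import Relation.Nullary.Decidable using (dec-true; dec-false; _⊎-dec_; _×-dec_; map′)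
open import Relation.Unary using (Decidable)
open import Relation.Binary.Definitions using (DecidableEquality)
open import Relation.Binary.PropositionalEquality hiding ([_])
open import Algebra.Properties.CommutativeMonoid.Sum +-0-commutativeMonoid
  using (sum; sum-cong-≗; ∑-comm; ∑-distrib-+)

⟦_⟧ : Bool → ℕ
⟦ b ⟧ = if b then 1 else 0

∧-intro : ∀ {a b} → a ≡ true → b ≡ true → (a ∧ b) ≡ true
∧-intro refl refl = refl

∧-elim : ∀ {a b} → (a ∧ b) ≡ true → a ≡ true × b ≡ true
∧-elim {true} {true} _ = refl , refl

does-true : ∀ {a} {A : Set a} (a? : Dec A) → does a? ≡ true → A
does-true (yes a) _ = a

sumFin≡sum : ∀ {n} (f : Fin n → ℕ) → sumFin f ≡ sum f
sumFin≡sum {zero}  f = refl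
sumFin≡sum {suc n} f = cong (f zero +_) (sumFin≡sum (f ∘ suc))

sumFin-cong : ∀ {n} {f g : Fin n → ℕ} → (∀ i → f i ≡ g i) → sumFin f ≡ sumFin g
sumFin-cong {f = f} {g} f≗g =
  trans (sumFin≡sum f) (trans (sum-cong-≗ f≗g) (sym (sumFin≡sum g)))

sumFin-+ : ∀ {n} (f g : Fin n → ℕ) → sumFin (λ i → f i + g i) ≡ sumFin f + sumFin g
sumFin-+ f g = begin
  sumFin (λ i → f i + g i) ≡⟨ sumFin≡sum (λ i → f i + g i) ⟩
  sum (λ i → f i + g i)    ≡⟨ ∑-distrib-+ f g ⟩
  sum f + sum g            ≡⟨ cong₂ _+_ (sumFin≡sum f) (sumFin≡sum g) ⟨
  sumFin f + sumFin g      ∎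
  where open ≡-Reasoning

sumFin-comm : ∀ {n k} (h : Fin n → Fin k → ℕ) →
  sumFin (λ i → sumFin (h i)) ≡ sumFin (λ j → sumFin (λ i → h i j))
sumFin-comm h = begin
  sumFin (λ i → sumFin (h i))             ≡⟨ sumFin-cong (λ i → sumFin≡sum (h i)) ⟩
  sumFin (λ i → sum (h i))                ≡⟨ sumFin≡sum (λ i → sum (h i)) ⟩
  sum (λ i → sum (h i))                   ≡⟨ ∑-comm h ⟩
  sum (λ j → sum (λ i → h i j))           ≡⟨ sumFin≡sum (λ j → sum (λ i → h i j)) ⟨
  sumFin (λ j → sum (λ i → h i j))        ≡⟨ sumFin-cong (λ j → sumFin≡sum (λ i → h i j)) ⟨
  sumFin (λ j → sumFin (λ i → h i j))     ∎
  where open ≡-Reasoning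

sumFin-mono : ∀ {n} {f g : Fin n → ℕ} → (∀ i → f i ≤ g i) → sumFin f ≤ sumFin g
sumFin-mono {zero}  f≤g = z≤n
sumFin-mono {suc n} f≤g = +-mono-≤ (f≤g zero) (sumFin-mono (f≤g ∘ suc))

sumFin-mono-< : ∀ {n} {f g : Fin n → ℕ} → (∀ i → f i ≤ g i) →
  ∀ i₀ → f i₀ < g i₀ → sumFin f < sumFin g
sumFin-mono-< f≤g zero    lt = +-mono-<-≤ lt (sumFin-mono (f≤g ∘ suc))
sumFin-mono-< f≤g (suc i) lt = +-mono-≤-< (f≤g zero) (sumFin-mono-< (f≤g ∘ suc) i lt)

term≤sumFin : ∀ {n} (f : Fin n → ℕ) i → f i ≤ sumFin f
term≤sumFin f zero    = m≤m+n _ _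
term≤sumFin f (suc i) = ≤-trans (term≤sumFin (f ∘ suc) i) (m≤n+m _ _)

countFin≡sumFin : ∀ {n} (f : Fin n → Bool) → countFin f ≡ sumFin (λ i → ⟦ f i ⟧)
countFin≡sumFin {zero}  f = refl
countFin≡sumFin {suc n} f = cong (⟦ f zero ⟧ +_) (countFin≡sumFin (f ∘ suc))

∣∣≡countFin : ∀ {n} (p : Subset n) → ∣ p ∣ ≡ countFin (lookup p)
∣∣≡countFin []          = refl
∣∣≡countFin (true ∷ p)  = cong suc (∣∣≡countFin p)
∣∣≡countFin (false ∷ p) = ∣∣≡countFin p

count-pos : ∀ {n} (f : Fin n → Bool) i → f i ≡ true → 1 ≤ countFin f
count-pos f i fi = begin
  1                         ≡⟨ cong ⟦_⟧ fi ⟨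
  ⟦ f i ⟧                   ≤⟨ term≤sumFin (λ k → ⟦ f k ⟧) i ⟩
  sumFin (λ k → ⟦ f k ⟧)    ≡⟨ countFin≡sumFin f ⟨
  countFin f                ∎
  where open ≤-Reasoning

count-zero : ∀ {n} (f : Fin n → Bool) → (∀ i → f i ≡ false) → countFin f ≡ 0
count-zero {zero}  f none = refl
count-zero {suc n} f none rewrite none zero = count-zero (f ∘ suc) (none ∘ suc)

AtMostOne : ∀ {n} → (Fin n → Bool) → Set
AtMostOne f = ∀ a b → f a ≡ true → f b ≡ true → a ≡ b

count-≤1 : ∀ {n} (f : Fin n → Bool) → AtMostOne f → countFin f ≤ 1
count-≤1 {zero}  f one = z≤n
count-≤1 {suc n} f one with f zero in f₀
... | true  = s≤s (≤-reflexive (count-zero (f ∘ suc) others))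
  where
  others : ∀ i → f (suc i) ≡ false
  others i = ¬-not (λ fi → Fin.0≢1+n (one zero (suc i) f₀ fi))
... | false = count-≤1 (f ∘ suc) (λ a b fa fb → Fin.suc-injective (one _ _ fa fb))

count-≤-⟦⟧ : ∀ {n} (f : Fin n → Bool) b → AtMostOne f →
  (∀ i → f i ≡ true → b ≡ true) → countFin f ≤ ⟦ b ⟧
count-≤-⟦⟧ f true  one _     = count-≤1 f one
count-≤-⟦⟧ f false _   force =
  ≤-reflexive (count-zero f (λ i → ¬-not (λ fi → false≢true (force i fi))))
  where
  false≢true : false ≢ true
  false≢true ()

count-one : ∀ {n} (f : Fin n → Bool) j₀ → f j₀ ≡ true → (∀ j → f j ≡ true → j ≡ j₀) →
  countFin f ≡ 1
count-one f j₀ fj₀ only = ≤-antisym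
  (count-≤1 f (λ a b fa fb → trans (only a fa) (sym (only b fb))))
  (count-pos f j₀ fj₀)

mask-count : ∀ {n} b (f : Fin n → Bool) → (if b then countFin f else 0) ≡ countFin (λ j → b ∧ f j)
mask-count true  f = refl
mask-count false f = sym (count-zero (λ j → false ∧ f j) (λ _ → refl))

count-<⇒false : ∀ {n} (f : Fin n → Bool) → countFin f < n → ∃[ j ] f j ≡ false
count-<⇒false {suc n} f lt with f zero in f₀
... | false = zero , f₀
... | true  = let j , fj = count-<⇒false (f ∘ suc) (≤-pred lt) in suc j , fj

anyFin-intro : ∀ {n} (f : Fin n → Bool) i → f i ≡ true → anyFin f ≡ true
anyFin-intro f zero    fi rewrite fi = refl
anyFin-intro f (suc i) fi with f zero
... | true  = refl
... | false = anyFin-intro (f ∘ suc) i fi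

module _ {m r : ℕ} where

  _≟V_ : DecidableEquality (Vtx {m} {r})
  _≟V_ = ≡-dec Fin._≟_ Fin._≟_

  ∃V? : ∀ {p} {P : Vtx {m} {r} → Set p} → Decidable P → Dec (∃ P)
  ∃V? P? = map′ join split (Fin.any? (P? ∘ inj₁) ⊎-dec Fin.any? (P? ∘ inj₂))
    where
    join = λ { (inj₁ (i , pi)) → inj₁ i , pi ; (inj₂ (j , pj)) → inj₂ j , pj }
    split = λ { (inj₁ i , pi) → inj₁ (i , pi) ; (inj₂ j , pj) → inj₂ (j , pj) }

  module _ {T : BipGraph m r} where

    adj? : ∀ u v → Dec (Adj T u v)
    adj? (inj₁ i) (inj₂ j) = T i j ≟B true
    adj? (inj₂ j) (inj₁ i) = T i j ≟B true
    adj? (inj₁ _) (inj₁ _) = no λ ()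
    adj? (inj₂ _) (inj₂ _) = no λ ()

    adj-sym : ∀ {u v} → Adj T u v → Adj T v u
    adj-sym {inj₁ _} {inj₂ _} a = a
    adj-sym {inj₂ _} {inj₁ _} a = a

    adj-irrefl : ∀ {u v} → Adj T u v → u ≢ v
    adj-irrefl {inj₁ _} {inj₂ _} _ ()
    adj-irrefl {inj₂ _} {inj₁ _} _ ()

    -- In a connected graph every left vertex has a neighbour: the first step
    -- of a walk to a right vertex.
    left-has-neighbour : Connected T → ∀ i → ∃[ j ] T i j ≡ true
    left-has-neighbour connected i with connected (inj₁ i) (inj₂ zero)
    ... | cons {w = inj₂ j} t _ = j , t

    χ⁻¹-intro : ∀ (I' : Subset (suc r)) {i j} →
      lookup I' j ≡ true → T i j ≡ true → lookup (χ⁻¹ T I') i ≡ true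
    χ⁻¹-intro I' {i} {j} j∈I' t =
      trans (lookup∘tabulate (λ i′ → anyFin (λ j′ → lookup I' j′ ∧ T i′ j′)) i)
      (anyFin-intro (λ j′ → lookup I' j′ ∧ T i j′) j (∧-intro j∈I' t))

    χ-intro : ∀ (I : Subset m) {i j} →
      lookup I i ≡ true → T i j ≡ true → lookup (χ T I) j ≡ true
    χ-intro I {i} {j} i∈I t =
      trans (lookup∘tabulate (λ j′ → anyFin (λ i′ → lookup I i′ ∧ T i′ j′)) j)
      (anyFin-intro (λ i′ → lookup I i′ ∧ T i′ j) i (∧-intro i∈I t))

module Acyclicity {m r : ℕ} {T : BipGraph m r} (acyclic : Acyclic T) where

  Path : List (Vtx {m} {r}) → Set
  Path = Linked (Adj T)

  path⇒chain : ∀ {x z w} A {B} → Path (x ∷ A ++ z ∷ B) → Adj T z w → ChainTo T x (A ++ [ z ]) w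
  path⇒chain []      (xz ∷ _) zw = xz , zw
  path⇒chain (a ∷ A) (xa ∷ p) zw = xa , path⇒chain A p zw

  unique-prefix : ∀ (A : List (Vtx {m} {r})) {B} → Unique (A ++ B) → Unique A
  unique-prefix []      _        = AllPairs.[]
  unique-prefix (a ∷ A) (a∉ ∷ u) = ++⁻ˡ A a∉ ∷ unique-prefix A u

  -- On a path without repeated vertices x, y, …, the start x is adjacent to
  -- no vertex beyond y: the path back to x would close a cycle.
  no-shortcut : ∀ {x y z ws} → Unique (x ∷ y ∷ ws) → Path (x ∷ y ∷ ws) → z ∈ ws → ¬ Adj T z x
  no-shortcut {x} {y} {z} u p z∈ws zx with ∈-∃++ z∈ws
  ... | pre , post , refl = acyclic x (y ∷ pre ++ [ z ]) (long pre , distinct , chain)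
    where
    long : ∀ pre → 2 ≤ length (y ∷ pre ++ [ z ])
    long []      = s≤s (s≤s z≤n)
    long (_ ∷ _) = s≤s (s≤s z≤n)
    distinct : Unique (x ∷ y ∷ pre ++ [ z ])
    distinct = unique-prefix (x ∷ y ∷ pre ++ [ z ])
      (subst (λ l → Unique (x ∷ y ∷ l)) (sym (++-assoc pre [ z ] post)) u)
    chain : ChainTo T x (y ∷ pre ++ [ z ]) x
    chain = path⇒chain (y ∷ pre) p zx

least : ∀ {p} {P : ℕ → Set p} → Decidable P → ∀ {n} → P n → ∃[ k ] (P k × (∀ {j} → P j → k ≤ j))
least {P = P} P? {n} pn = search 0 n (λ ()) (subst P (sym (+-identityʳ n)) pn)
  where
  -- search k d: no witness lies below k, and d + k is a witness.
  search : ∀ k d → (∀ {j} → j < k → ¬ P j) → P (d + k) → ∃[ k ] (P k × (∀ {j} → P j → k ≤ j))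
  search k d below pd with P? k
  ... | yes pk = k , pk , λ pj → ≮⇒≥ (λ j<k → below j<k pj)
  search k zero    below pd | no ¬pk = ⊥-elim (¬pk pd)
  search k (suc d) below pd | no ¬pk = search (suc k) d below′ (subst P (sym (+-suc d k)) pd)
    where
    below′ : ∀ {j} → j < suc k → ¬ P j
    below′ j<1+k with m≤n⇒m<n∨m≡n (≤-pred j<1+k)
    ... | inj₁ j<k  = below j<k
    ... | inj₂ refl = ¬pk

record Rooting {m r : ℕ} (T : BipGraph m r) (ρ : Vtx {m} {r}) : Set where
  field
    parent       : Vtx {m} {r} → Vtx {m} {r}
    height       : Vtx {m} {r} → ℕ
    parent-root  : parent ρ ≡ ρ
    parent-adj   : ∀ {v} → v ≢ ρ → Adj T v (parent v)
    parent-lower : ∀ {v} → v ≢ ρ → height (parent v) < height v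

module BreadthFirst {m r : ℕ} {T : BipGraph m r} (connected : Connected T) (ρ : Vtx {m} {r}) where

  -- Reach k v: v is joined to ρ by a walk with at most k edges.
  Reach : ℕ → Vtx {m} {r} → Set
  Reach zero    v = v ≡ ρ
  Reach (suc k) v = Reach k v ⊎ ∃[ w ] (Adj T v w × Reach k w)

  reach? : ∀ k → Decidable (Reach k)
  reach? zero    v = v ≟V ρ
  reach? (suc k) v = reach? k v ⊎-dec ∃V? (λ w → adj? v w ×-dec reach? k w)

  walk⇒reach : ∀ {v} → Walk T v ρ → ∃[ k ] Reach k v
  walk⇒reach nil        = 0 , refl
  walk⇒reach (cons a w) = let k , reach = walk⇒reach w in suc k , inj₂ (_ , a , reach)

  distance : ∀ v → ∃[ k ] (Reach k v × (∀ {j} → Reach j v → k ≤ j))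
  distance v = least (λ k → reach? k v) (proj₂ (walk⇒reach (connected v ρ)))

  height : Vtx {m} {r} → ℕ
  height v = proj₁ (distance v)

  descend : ∀ {v} → v ≢ ρ → ∃[ w ] (Adj T v w × height w < height v)
  descend {v} v≢ρ = step (proj₁ (proj₂ (distance v))) (proj₂ (proj₂ (distance v)))
    where
    step : ∀ {h} → Reach h v → (∀ {j} → Reach j v → h ≤ j) → ∃[ w ] (Adj T v w × height w < h)
    step {zero}  v≡ρ                 _       = ⊥-elim (v≢ρ v≡ρ)
    step {suc k} (inj₁ nearer)       minimal = ⊥-elim (1+n≰n (minimal nearer))
    step {suc k} (inj₂ (w , a , wk)) _       = w , a , s≤s (proj₂ (proj₂ (distance w)) wk)

  parent-by : ∀ v → Dec (v ≡ ρ) → Vtx {m} {r}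
  parent-by v (yes _)   = ρ
  parent-by v (no v≢ρ) = proj₁ (descend v≢ρ)

  parent : Vtx {m} {r} → Vtx {m} {r}
  parent v = parent-by v (v ≟V ρ)

  parent-step : ∀ {v} → v ≢ ρ → Adj T v (parent v) × height (parent v) < height v
  parent-step {v} v≢ρ = step-by (v ≟V ρ)
    where
    step-by : (d : Dec (v ≡ ρ)) → Adj T v (parent-by v d) × height (parent-by v d) < height v
    step-by (yes v≡ρ) = ⊥-elim (v≢ρ v≡ρ)
    step-by (no v≢ρ′) = proj₂ (descend v≢ρ′)

  rooting : Rooting T ρ
  rooting = record
    { parent       = parent
    ; height       = height
    ; parent-root  = root (ρ ≟V ρ)
    ; parent-adj   = proj₁ ∘ parent-step
    ; parent-lower = proj₂ ∘ parent-step
    }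
    where
    root : (d : Dec (ρ ≡ ρ)) → parent-by ρ d ≡ ρ
    root (yes _)   = refl
    root (no ρ≢ρ) = ⊥-elim (ρ≢ρ refl)

-- In a rooted acyclic graph every edge joins a vertex to its parent

module RootedTree {m r : ℕ} {T : BipGraph m r} (acyclic : Acyclic T)
                  {ρ : Vtx {m} {r}} (R : Rooting T ρ) where

  open Rooting R
  open Acyclicity acyclic

  V : Set
  V = Vtx {m} {r}

  open DecMembership (_≟V_ {m} {r}) using (_∈?_)

  proper-parent : ∀ {u v} → parent u ≡ v → u ≢ v → Adj T u v × height v < height u
  proper-parent {u} refl u≢pu = parent-adj u≢ρ , parent-lower u≢ρ
    where
    u≢ρ : u ≢ ρ
    u≢ρ refl = u≢pu (sym parent-root)

  root-fixed : ∀ {v} → v ≡ ρ → parent v ≡ v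
  root-fixed refl = parent-root

  parent-height-≤ : ∀ v → height (parent v) ≤ height v
  parent-height-≤ v with v ≟V ρ
  ... | yes refl = ≤-reflexive (cong height parent-root)
  ... | no v≢ρ   = <⇒≤ (parent-lower v≢ρ)

  no-2-cycle : ∀ {u v} → parent u ≡ v → parent v ≡ u → u ≢ v → ⊥
  no-2-cycle pu pv u≢v =
    <-asym (proj₂ (proper-parent pu u≢v)) (proj₂ (proper-parent pv (u≢v ∘ sym)))

  grandparent≢ : ∀ {x} → x ≢ ρ → parent (parent x) ≢ x
  grandparent≢ {x} x≢ρ ppx≡x = <-irrefl refl
    (≤-<-trans (subst (λ w → height w ≤ height (parent x)) ppx≡x (parent-height-≤ (parent x)))
               (parent-lower x≢ρ))

  ancestors : ℕ → V → List V
  ancestors zero    v = []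
  ancestors (suc n) v with v ≟V ρ
  ... | yes _ = []
  ... | no _  = parent v ∷ ancestors n (parent v)

  Headed : V → List V → Set
  Headed y []      = ⊤
  Headed y (z ∷ _) = y ≡ z

  ancestors-headed : ∀ n v → Headed (parent v) (ancestors n v)
  ancestors-headed zero    v = tt
  ancestors-headed (suc n) v with v ≟V ρ
  ... | yes _ = tt
  ... | no _  = refl

  ancestors-path : ∀ n v → Path (v ∷ ancestors n v)
  ancestors-path zero    v = [-]
  ancestors-path (suc n) v with v ≟V ρ
  ... | yes _   = [-]
  ... | no v≢ρ = parent-adj v≢ρ ∷ ancestors-path n (parent v)

  ancestors-descend : ∀ n v → AllPairs (λ a b → height b < height a) (v ∷ ancestors n v)
  ancestors-descend zero    v = All.[] ∷ AllPairs.[]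
  ancestors-descend (suc n) v with v ≟V ρ
  ... | yes _   = All.[] ∷ AllPairs.[]
  ... | no v≢ρ with ancestors-descend n (parent v)
  ... | below ∷ rest = (lower ∷ All.map (λ lt → <-trans lt lower) below) ∷ below ∷ rest
    where
    lower = parent-lower v≢ρ

  ancestors-unique : ∀ n v → Unique (v ∷ ancestors n v)
  ancestors-unique n v = AllPairs.map (λ { lt refl → <-irrefl refl lt }) (ancestors-descend n v)

  ancestors-root : ∀ n v → height v ≤ n → ρ ∈ v ∷ ancestors n v
  ancestors-root zero v h≤0 with v ≟V ρ
  ... | yes v≡ρ = here (sym v≡ρ)
  ... | no v≢ρ  = ⊥-elim (n≮0 (≤-trans (parent-lower v≢ρ) h≤0))
  ancestors-root (suc n) v h≤n with v ≟V ρ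
  ... | yes v≡ρ = here (sym v≡ρ)
  ... | no v≢ρ  = there (ancestors-root n (parent v) (≤-pred (≤-trans (parent-lower v≢ρ) h≤n)))

  -- Climbing: let x, y, … be a path without repeats that contains ρ after x,
  -- and whose second vertex is not the parent of x.  Prepending parents to it
  -- keeps these properties until a parent already lies on the path, which
  -- closes a cycle; the root itself is never reached.  So no such path exists.
  no-climbing-path : ∀ n x y rest → height x ≤ n → Unique (x ∷ y ∷ rest) →
    Path (x ∷ y ∷ rest) → parent x ≢ y → ρ ∈ y ∷ rest → ⊥
  no-climbing-path n x y rest h≤n u@(x∉ ∷ _) p px≢y ρ∈ with x ≟V ρ
  ... | yes refl = All.lookup x∉ ρ∈ refl
  ... | no x≢ρ with parent x ∈? (y ∷ rest)
  ...   | yes (here px≡y)    = px≢y px≡y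
  ...   | yes (there px∈rest) = no-shortcut u p px∈rest (adj-sym (parent-adj x≢ρ))
  ...   | no px∉ = climb n h≤n
    where
    lower = parent-lower x≢ρ
    climb : ∀ k → height x ≤ k → ⊥
    climb zero    h≤0   = n≮0 (≤-trans lower h≤0)
    climb (suc k) h≤1+k = no-climbing-path k (parent x) x (y ∷ rest)
      (≤-pred (≤-trans lower h≤1+k))
      (((λ px≡x → <-irrefl (cong height px≡x) lower) ∷ ¬Any⇒All¬ _ px∉) ∷ u)
      (adj-sym (parent-adj x≢ρ) ∷ p)
      (grandparent≢ x≢ρ)
      (there ρ∈)

  not-ancestor : ∀ {u v ys} → Adj T u v → parent u ≢ v → Unique (u ∷ ys) → Path (u ∷ ys) →
    Headed (parent u) ys → v ∉ u ∷ ys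
  not-ancestor uv _    _ _ _  (here v≡u)               = adj-irrefl uv (sym v≡u)
  not-ancestor _  pu≢v _ _ pu (there (here v≡y))       = pu≢v (trans pu (sym v≡y))
  not-ancestor uv _    u p _  (there (there v∈ws))     = no-shortcut u p v∈ws (adj-sym uv)

  parent-edge : ∀ {u v} → Adj T u v → parent u ≡ v ⊎ parent v ≡ u
  parent-edge {u} {v} uv with parent u ≟V v | parent v ≟V u
  ... | yes pu≡v | _        = inj₁ pu≡v
  ... | no _     | yes pv≡u = inj₂ pv≡u
  ... | no pu≢v  | no pv≢u  = ⊥-elim (no-climbing-path (height v) v u lineage ≤-refl
         (v∉lineage ∷ unique) (adj-sym uv ∷ path) pv≢u (ancestors-root n u ≤-refl))
    where
    n = height u
    lineage = ancestors n u
    unique = ancestors-unique n u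
    path = ancestors-path n u
    v∉lineage : All (v ≢_) (u ∷ lineage)
    v∉lineage = ¬Any⇒All¬ _ (not-ancestor uv pu≢v unique path (ancestors-headed n u))

-- Counting children in a rooted acyclic bipartite graph

module Children {m r : ℕ} {T : BipGraph m r} (acyclic : Acyclic T)
                {ρ : Vtx {m} {r}} (R : Rooting T ρ) where

  open Rooting R
  open RootedTree acyclic R

  isChild : Fin m → Fin (suc r) → Bool
  isChild i j = does (parent (inj₂ j) ≟V inj₁ i)

  isParentOf : Fin m → Fin (suc r) → Bool
  isParentOf i j = does (parent (inj₁ i) ≟V inj₂ j)

  children : Fin m → ℕ
  children i = countFin (isChild i)

  child-adj : ∀ {i j} → isChild i j ≡ true → T i j ≡ true
  child-adj {i} {j} c = proj₁ (proper-parent (does-true (parent (inj₂ j) ≟V inj₁ i) c) λ ())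

  one-parent : ∀ j → AtMostOne (λ i → isChild i j)
  one-parent j a b ca cb =
    inj₁-injective (trans (sym (does-true (parent (inj₂ j) ≟V inj₁ a) ca))
                          (does-true (parent (inj₂ j) ≟V inj₁ b) cb))

  right-has-parent : ∀ {j} → inj₂ j ≢ ρ → ∃[ i ] (isChild i j ≡ true × T i j ≡ true)
  right-has-parent {j} j≢ρ = left (parent-adj j≢ρ) refl
    where
    left : ∀ {w} → Adj T (inj₂ j) w → parent (inj₂ j) ≡ w →
           ∃[ i ] (isChild i j ≡ true × T i j ≡ true)
    left {inj₁ i} t pj≡i = i , dec-true (parent (inj₂ j) ≟V inj₁ i) pj≡i , t

  edge-indicator : ∀ i j → ⟦ T i j ⟧ ≡ ⟦ isChild i j ⟧ + ⟦ isParentOf i j ⟧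
  edge-indicator i j = split (parent (inj₂ j) ≟V inj₁ i) (parent (inj₁ i) ≟V inj₂ j)
    where
    split : (down : Dec (parent (inj₂ j) ≡ inj₁ i)) (up : Dec (parent (inj₁ i) ≡ inj₂ j)) →
            ⟦ T i j ⟧ ≡ ⟦ does down ⟧ + ⟦ does up ⟧
    split (yes down) (yes up) = ⊥-elim (no-2-cycle down up λ ())
    split (yes down) (no _)   = cong ⟦_⟧ (proj₁ (proper-parent down λ ()))
    split (no _)     (yes up) = cong ⟦_⟧ (proj₁ (proper-parent up λ ()))
    split (no ¬down) (no ¬up) = cong ⟦_⟧ (¬-not λ edge → [ ¬up , ¬down ]′ (parent-edge edge))

  degree : ∀ i → degL T i ≡ children i + countFin (isParentOf i)
  degree i = begin
    degL T i                                                   ≡⟨ countFin≡sumFin (T i) ⟩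
    sumFin (λ j → ⟦ T i j ⟧)                                   ≡⟨ sumFin-cong (edge-indicator i) ⟩
    sumFin (λ j → ⟦ isChild i j ⟧ + ⟦ isParentOf i j ⟧)
      ≡⟨ sumFin-+ (λ j → ⟦ isChild i j ⟧) (λ j → ⟦ isParentOf i j ⟧) ⟩
    sumFin (λ j → ⟦ isChild i j ⟧) + sumFin (λ j → ⟦ isParentOf i j ⟧)
      ≡⟨ cong₂ _+_ (countFin≡sumFin (isChild i)) (countFin≡sumFin (isParentOf i)) ⟨
    children i + countFin (isParentOf i)                       ∎
    where open ≡-Reasoning

  parents-nonroot : ∀ {i} → inj₁ i ≢ ρ → countFin (isParentOf i) ≡ 1
  parents-nonroot {i} i≢ρ = right (parent-adj i≢ρ) refl
    where
    right : ∀ {w} → Adj T (inj₁ i) w → parent (inj₁ i) ≡ w → countFin (isParentOf i) ≡ 1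
    right {inj₂ j₀} _ pi≡j₀ =
      count-one (isParentOf i) j₀ (dec-true (parent (inj₁ i) ≟V inj₂ j₀) pi≡j₀)
      (λ j pi≡j → inj₂-injective (trans (sym (does-true (parent (inj₁ i) ≟V inj₂ j) pi≡j)) pi≡j₀))

  root-parent-left : ∀ {i j} → inj₁ i ≡ ρ → parent (inj₁ i) ≢ inj₂ j
  root-parent-left i≡ρ pi≡j with trans (sym (root-fixed i≡ρ)) pi≡j
  ... | ()

  parents-root : ∀ {i} → inj₁ i ≡ ρ → countFin (isParentOf i) ≡ 0
  parents-root {i} i≡ρ =
    count-zero (isParentOf i) (λ j → dec-false (parent (inj₁ i) ≟V inj₂ j) (root-parent-left i≡ρ))

  leftDeg-nonroot : ∀ {i} → inj₁ i ≢ ρ → leftDeg T i ≡ children i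
  leftDeg-nonroot {i} i≢ρ = begin
    degL T i ∸ 1                                 ≡⟨ cong (_∸ 1) (degree i) ⟩
    children i + countFin (isParentOf i) ∸ 1     ≡⟨ cong (λ k → children i + k ∸ 1) (parents-nonroot i≢ρ) ⟩
    children i + 1 ∸ 1                           ≡⟨ m+n∸n≡m (children i) 1 ⟩
    children i                                   ∎
    where open ≡-Reasoning

  degL-root : ∀ {i} → inj₁ i ≡ ρ → degL T i ≡ children i
  degL-root {i} i≡ρ =
    trans (degree i) (trans (cong (children i +_) (parents-root i≡ρ)) (+-identityʳ (children i)))

  leftDeg≤children : ∀ i → leftDeg T i ≤ children i
  leftDeg≤children i with inj₁ i ≟V ρ
  ... | yes i≡ρ = ≤-trans (m∸n≤m (degL T i) 1) (≤-reflexive (degL-root i≡ρ))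
  ... | no i≢ρ  = ≤-reflexive (leftDeg-nonroot i≢ρ)

  -- A left root with a neighbour j has j as a child, so d_i < ch(i) there.
  leftDeg-root-< : ∀ {i j} → inj₁ i ≡ ρ → T i j ≡ true → leftDeg T i < children i
  leftDeg-root-< {i} {j} i≡ρ t = subst (λ d → d ∸ 1 < children i) (sym (degL-root i≡ρ))
    (∸-monoʳ-< {children i} {1} {0} (s≤s z≤n) has-child)
    where
    has-child : 1 ≤ children i
    has-child with parent-edge {inj₁ i} {inj₂ j} t
    ... | inj₂ pj≡i = count-pos (isChild i) j (dec-true (parent (inj₂ j) ≟V inj₁ i) pj≡i)
    ... | inj₁ pi≡j = ⊥-elim (root-parent-left i≡ρ pi≡j)

  children-by-columns : (X : Fin m → Bool) →
    sumFin (λ i → if X i then children i else 0) ≡ sumFin (λ j → countFin (λ i → X i ∧ isChild i j))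
  children-by-columns X = begin
    sumFin (λ i → if X i then children i else 0)      ≡⟨ sumFin-cong row ⟩
    sumFin (λ i → sumFin (λ j → ⟦ X i ∧ isChild i j ⟧)) ≡⟨ sumFin-comm (λ i j → ⟦ X i ∧ isChild i j ⟧) ⟩
    sumFin (λ j → sumFin (λ i → ⟦ X i ∧ isChild i j ⟧))
      ≡⟨ sumFin-cong (λ j → countFin≡sumFin (λ i → X i ∧ isChild i j)) ⟨
    sumFin (λ j → countFin (λ i → X i ∧ isChild i j))  ∎
    where
    open ≡-Reasoning
    row : ∀ i → (if X i then children i else 0) ≡ sumFin (λ j → ⟦ X i ∧ isChild i j ⟧)
    row i = trans (mask-count (X i) (isChild i)) (countFin≡sumFin (λ j → X i ∧ isChild i j))

module _ {m r : ℕ} {T : BipGraph m r} (connected : Connected T) (acyclic : Acyclic T) where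

  -- |I'| ≤ LD_T(χ⁻¹(I')) when some right vertex j₀ lies outside I': root T at
  -- j₀; each j ∈ I' then has a parent in χ⁻¹(I'), and d_i = ch(i) for every i.
  right-bound : (I' : Subset (suc r)) → ∣ I' ∣ < suc r → ∣ I' ∣ ≤ LD T (χ⁻¹ T I')
  right-bound I' small = begin
    ∣ I' ∣                                             ≡⟨ ∣∣≡countFin I' ⟩
    countFin (lookup I')                               ≡⟨ countFin≡sumFin (lookup I') ⟩
    sumFin (λ j → ⟦ lookup I' j ⟧)                     ≤⟨ sumFin-mono has-parent ⟩
    sumFin (λ j → countFin (λ i → X i ∧ isChild i j))  ≡⟨ children-by-columns X ⟨
    sumFin (λ i → if X i then children i else 0)
      ≡⟨ sumFin-cong (λ i → cong (λ d → if X i then d else 0) (leftDeg-nonroot λ ())) ⟨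
    LD T (χ⁻¹ T I')                                    ∎
    where
    open ≤-Reasoning
    outside = count-<⇒false (lookup I') (subst (_< suc r) (∣∣≡countFin I') small)
    j₀ = proj₁ outside
    open Children acyclic (BreadthFirst.rooting connected (inj₂ j₀))
    X = lookup (χ⁻¹ T I')
    has-parent : ∀ j → ⟦ lookup I' j ⟧ ≤ countFin (λ i → X i ∧ isChild i j)
    has-parent j with lookup I' j in j∈I'
    ... | false = z≤n
    ... | true  = let i , ij , t = right-has-parent j≢j₀ in
                  count-pos (λ i → X i ∧ isChild i j) i (∧-intro (χ⁻¹-intro {T = T} I' j∈I' t) ij)
      where
      j≢j₀ : inj₂ j ≢ inj₂ j₀
      j≢j₀ refl with trans (sym j∈I') (proj₂ outside)
      ... | ()

  -- LD_T(I) + 1 ≤ |χ_T(I)| for I ∋ i₀: root T at i₀; then d_i ≤ ch(i) with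
  -- strict inequality at i₀, and distinct children of I lie in χ_T(I).
  left-bound : (I : Subset m) → Nonempty I → LD T I + 1 ≤ ∣ χ T I ∣
  left-bound I (i₀ , i₀∈I) = begin
    LD T I + 1                                                ≡⟨ +-comm (LD T I) 1 ⟩
    suc (LD T I)                                              ≤⟨ sumFin-mono-< masked-≤ i₀ masked-< ⟩
    sumFin (λ i → if X i then children i else 0)              ≡⟨ children-by-columns X ⟩
    sumFin (λ j → countFin (λ i → X i ∧ isChild i j))         ≤⟨ sumFin-mono in-χ ⟩
    sumFin (λ j → ⟦ lookup (χ T I) j ⟧)                       ≡⟨ countFin≡sumFin (lookup (χ T I)) ⟨
    countFin (lookup (χ T I))                                 ≡⟨ ∣∣≡countFin (χ T I) ⟨
    ∣ χ T I ∣                                                 ∎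
    where
    open ≤-Reasoning
    open Children acyclic (BreadthFirst.rooting connected (inj₁ i₀))
    X = lookup I
    masked-≤ : ∀ i → (if X i then leftDeg T i else 0) ≤ (if X i then children i else 0)
    masked-≤ i with X i
    ... | true  = leftDeg≤children i
    ... | false = z≤n
    masked-< : (if X i₀ then leftDeg T i₀ else 0) < (if X i₀ then children i₀ else 0)
    masked-< rewrite []=⇒lookup i₀∈I =
      leftDeg-root-< refl (proj₂ (left-has-neighbour connected i₀))
    in-χ : ∀ j → countFin (λ i → X i ∧ isChild i j) ≤ ⟦ lookup (χ T I) j ⟧
    in-χ j = count-≤-⟦⟧ (λ i → X i ∧ isChild i j) (lookup (χ T I) j)
      (λ a b ca cb → one-parent j a b (proj₂ (∧-elim ca)) (proj₂ (∧-elim cb)))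
      (λ i c → χ-intro {T = T} I (proj₁ (∧-elim c)) (child-adj (proj₂ (∧-elim c))))

-- Theorem 8.

mainTheorem8 : (m r : ℕ) (G T : BipGraph m r) → NoIsolated G → IsSpanningTree T G →
    ((I' : Subset (suc r)) → ∣ I' ∣ < suc r → ∣ I' ∣ ≤ LD T (χ⁻¹ T I'))
    × ((I : Subset m) → Nonempty I → ∣ I ∣ < m → LD T I + 1 ≤ ∣ χ T I ∣)
mainTheorem8 m r G T _ (_ , connected , acyclic) =
  right-bound connected acyclic , λ I nonempty _ → left-bound connected acyclic I nonempty
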